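{- For every real $\varepsilon\in[0,1]$ and every cograph $G$, there exists $X\subseteq V(G)$ with $|X|\ge \varepsilon|G|$ such that one of $G[X]$, $\overline{G}[X]$ has maximum degree at most $\varepsilon^2|G|$ (and hence at most $\varepsilon|X|$).
   Context: All graphs are finite and simple. $|G|$ denotes the number of vertices of $G$, $G[X]$ the induced subgraph on $X$, and $\overline{G}$ the complement of $G$. A cograph is a graph with no induced subgraph isomorphic to $P_4$, the path on four vertices.
   Formalization: The parameter ε ranges over the rationals in [0,1] instead of the reals. -}

module Defs where

open import Data.Nat using (ℕ)
open import Data.Bool using (Bool; true; false; not; if_then_else_)
open import Data.Fin using (Fin; zero; suc; _≟_)
open import Data.Fin.Subset using (Subset; _∈_; _∩_; ∣_∣)
open import Data.Vec using (tabulate)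
open import Data.Product using (Σ; _×_)
open import Data.Integer using (+_)
open import Data.Rational using (ℚ; _/_)
open import Function.Definitions using (Injective)
open import Relation.Nullary using (¬_; yes; no)
open import Relation.Binary.PropositionalEquality using (_≡_; refl)

record Graph (n : ℕ) : Set where
  field
    adj    : Fin n → Fin n → Bool
    sym    : ∀ i j → adj i j ≡ adj j i
    irrefl : ∀ i → adj i i ≡ false
open Graph public

compAdj : ∀ {n} → Graph n → Fin n → Fin n → Bool
compAdj G i j with i ≟ j
... | yes _ = false
... | no  _ = not (adj G i j)

private
  compSym : ∀ {n} (G : Graph n) i j → compAdj G i j ≡ compAdj G j i
  compSym G i j with i ≟ j | j ≟ i
  ... | yes _ | yes _ = refl
  ... | yes refl | no ¬q = Data.Empty.⊥-elim (¬q refl)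
    where import Data.Empty
  ... | no ¬p | yes refl = Data.Empty.⊥-elim (¬p refl)
    where import Data.Empty
  ... | no _ | no _ rewrite Graph.sym G i j = refl

  compIrr : ∀ {n} (G : Graph n) i → compAdj G i i ≡ false
  compIrr G i with i ≟ i
  ... | yes _ = refl
  ... | no ¬p = Data.Empty.⊥-elim (¬p refl)
    where import Data.Empty

complement : ∀ {n} → Graph n → Graph n
complement G = record { adj = compAdj G ; sym = compSym G ; irrefl = compIrr G }

p4adj : Fin 4 → Fin 4 → Bool
p4adj zero (suc zero) = true
p4adj (suc zero) zero = true
p4adj (suc zero) (suc (suc zero)) = true
p4adj (suc (suc zero)) (suc zero) = true
p4adj (suc (suc zero)) (suc (suc (suc zero))) = true
p4adj (suc (suc (suc zero))) (suc (suc zero)) = true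
p4adj _ _ = false

HasInducedP4 : ∀ {n} → Graph n → Set
HasInducedP4 {n} G =
  Σ (Fin 4 → Fin n) λ f → Injective _≡_ _≡_ f × (∀ a b → adj G (f a) (f b) ≡ p4adj a b)

Cograph : ∀ {n} → Graph n → Set
Cograph G = ¬ HasInducedP4 G

nbhd : ∀ {n} → Graph n → Fin n → Subset n
nbhd G v = tabulate (adj G v)

degIn : ∀ {n} → Graph n → Subset n → Fin n → ℕ
degIn G X v = ∣ X ∩ nbhd G v ∣

toℚ : ℕ → ℚ
toℚ m = (+ m) / 1

MaxDegreeAtMost : ∀ {n} → Graph n → Subset n → ℚ → Set
MaxDegreeAtMost G X b = ∀ v → v ∈ X → toℚ (degIn G X v) Data.Rational.≤ b

{-# OPTIONS --safe #-}
module Submission where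

-- A cograph G[U] on at least two vertices is disconnected or has a disconnected complement.
-- Hence, by induction on |U|, for every k ≤ |U| there are S, C ⊆ U with Δ(G[S]) < k,
-- Δ(Ḡ[C]) < k and k·|U| ≤ |S|·|C|: if G[U] = A ⊔ B, take the union of the two S's and the
-- larger of the two C's (argue in Ḡ if Ḡ[U] is the disconnected one).  For k = ⌈ε²n⌉ the
-- larger of S and C has at least √(kn) ≥ εn vertices, and its degrees are < k, i.e. ≤ ε²n.

open import Defs hiding (sym)
open import Data.Bool using (Bool; true; false; not)
open import Data.Bool.Properties using (not-¬; ¬-not; not-involutive) renaming (_≟_ to _≟ᵇ_)
open import Data.Fin using (Fin; zero; suc; #_; _≟_)
open import Data.Fin.Properties using (any?; all?)
open import Data.Fin.Subset
open import Data.Fin.Subset.Properties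
open import Data.Integer using (+_; +≤+)
import Data.Integer as ℤ
import Data.Integer.Properties as ℤ
open import Data.Nat using (ℕ; zero; suc; z≤n)
import Data.Nat as ℕ
import Data.Nat.Properties as ℕ
open import Data.Nat.Coprimality using (1-coprimeTo)
import Data.Nat.Coprimality as Coprimality
open import Data.Nat.Induction using (<-wellFounded)
open import Data.Product using (Σ; ∃-syntax; _×_; _,_)
import Data.Product as Product
open import Data.Sum using (_⊎_; inj₁; inj₂; [_,_]; map₂; swap)
import Data.Sum as Sum
open import Data.Vec using ([]; _∷_; here; there)
open import Data.Vec.Properties using ([]=⇒lookup; lookup⇒[]=; lookup∘tabulate; tabulate-cong)
open import Function using (_∘_)
open import Function.Definitions using (Injective)
open import Induction.WellFounded using (Acc; acc)
open import Relation.Nullary using (yes; no; contradiction)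
open import Relation.Nullary.Decidable using (toWitness; _×-dec_; _→-dec_)
open import Relation.Binary.PropositionalEquality
  using (_≡_; _≢_; refl; sym; trans; cong; subst; subst₂; module ≡-Reasoning)

private
  variable
    n k : ℕ
    H : Graph n
    p P Q U X : Subset n
    v x y : Fin n

x∈p─q⇒x∉q : ∀ (p q : Subset n) → x ∈ p ─ q → x ∉ q
x∈p─q⇒x∉q (_ ∷ _) (inside ∷ _) () here
x∈p─q⇒x∉q (_ ∷ p) (_ ∷ q) (there x∈p─q) (there x∈q) = x∈p─q⇒x∉q p q x∈p─q x∈q

x∈p-y⇒x≢y : ∀ (p : Subset n) → x ∈ p - y → x ≢ y
x∈p-y⇒x≢y {y = y} p x∈p-y refl = x∈p─q⇒x∉q p ⁅ y ⁆ x∈p-y (x∈⁅x⁆ y)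

⁅x⁆⊆p : x ∈ p → ⁅ x ⁆ ⊆ p
⁅x⁆⊆p {x = x} {p} x∈p y∈⁅x⁆ = subst (_∈ p) (sym (x∈⁅y⁆⇒x≡y x y∈⁅x⁆)) x∈p

constant-or-witness : (f : Fin n → Bool) (b : Bool) (X : Subset n) →
  (∀ {x} → x ∈ X → f x ≡ b) ⊎ ∃[ x ] x ∈ X × f x ≡ not b
constant-or-witness f b X with any? (λ x → x ∈? X ×-dec f x ≟ᵇ not b)
... | yes witness = inj₂ witness
... | no ¬witness = inj₁ λ {x} x∈X →
  trans (¬-not (λ fx≡¬b → ¬witness (x , x∈X , fx≡¬b))) (not-involutive b)

adj-sym : ∀ (H : Graph n) {b} → adj H x y ≡ b → adj H y x ≡ b
adj-sym {x = x} {y} H = trans (Graph.sym H y x)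

adj⇒≢ : ∀ (H : Graph n) → adj H x y ≡ true → x ≢ y
adj⇒≢ {x = x} H xy refl = not-¬ (irrefl H x) xy

∈nbhd⁺ : ∀ (H : Graph n) → adj H v x ≡ true → x ∈ nbhd H v
∈nbhd⁺ {v = v} {x} H vx = lookup⇒[]= x _ (trans (lookup∘tabulate (adj H v) x) vx)

∈nbhd⁻ : ∀ (H : Graph n) → x ∈ nbhd H v → adj H v x ≡ true
∈nbhd⁻ {x = x} {v} H x∈N = trans (sym (lookup∘tabulate (adj H v) x)) ([]=⇒lookup x∈N)

∉nbhd⁺ : ∀ (H : Graph n) → adj H v x ≡ false → x ∉ nbhd H v
∉nbhd⁺ H vx = not-¬ vx ∘ ∈nbhd⁻ H

∉nbhd⁻ : ∀ (H : Graph n) → x ∉ nbhd H v → adj H v x ≡ false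
∉nbhd⁻ H x∉N = ¬-not (x∉N ∘ ∈nbhd⁺ H)

complement-adj : ∀ (H : Graph n) → x ≢ y → adj (complement H) x y ≡ not (adj H x y)
complement-adj {x = x} {y} H x≢y with x ≟ y
... | yes x≡y = contradiction x≡y x≢y
... | no _ = refl

complement-false : ∀ (H : Graph n) → adj H x y ≡ true → adj (complement H) x y ≡ false
complement-false H xy = trans (complement-adj H (adj⇒≢ H xy)) (cong not xy)

complement-involutive : ∀ (H : Graph n) x y → adj (complement (complement H)) x y ≡ adj H x y
complement-involutive H x y with x ≟ y
... | yes refl = sym (irrefl H x)
... | no x≢y = trans (cong not (complement-adj H x≢y)) (not-involutive (adj H x y))

p4adj-rows-injective : ∀ a b → (∀ c → p4adj a c ≡ p4adj b c) → a ≡ b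
p4adj-rows-injective = toWitness {a? = all? λ a → all? λ b →
  all? (λ c → p4adj a c ≟ᵇ p4adj b c) →-dec a ≟ b} _

path⇒P4 : ∀ (H : Graph n) {p q r s} → adj H p q ≡ true → adj H q r ≡ true → adj H r s ≡ true →
  adj H p r ≡ false → adj H p s ≡ false → adj H q s ≡ false → HasInducedP4 H
path⇒P4 {n} H {p} {q} {r} {s} pq qr rs pr ps qs = f , f-injective , f-adj
  where
  f : Fin 4 → Fin n
  f zero = p
  f (suc zero) = q
  f (suc (suc zero)) = r
  f (suc (suc (suc zero))) = s
  f-adj : ∀ a b → adj H (f a) (f b) ≡ p4adj a b
  f-adj zero zero = irrefl H p
  f-adj zero (suc zero) = pq
  f-adj zero (suc (suc zero)) = pr
  f-adj zero (suc (suc (suc zero))) = ps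
  f-adj (suc zero) zero = adj-sym H pq
  f-adj (suc zero) (suc zero) = irrefl H q
  f-adj (suc zero) (suc (suc zero)) = qr
  f-adj (suc zero) (suc (suc (suc zero))) = qs
  f-adj (suc (suc zero)) zero = adj-sym H pr
  f-adj (suc (suc zero)) (suc zero) = adj-sym H qr
  f-adj (suc (suc zero)) (suc (suc zero)) = irrefl H r
  f-adj (suc (suc zero)) (suc (suc (suc zero))) = rs
  f-adj (suc (suc (suc zero))) zero = adj-sym H ps
  f-adj (suc (suc (suc zero))) (suc zero) = adj-sym H qs
  f-adj (suc (suc (suc zero))) (suc (suc zero)) = adj-sym H rs
  f-adj (suc (suc (suc zero))) (suc (suc (suc zero))) = irrefl H s
  f-injective : Injective _≡_ _≡_ f
  f-injective {a} {b} fa≡fb = p4adj-rows-injective a b λ c →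
    trans (sym (f-adj a c)) (trans (cong (λ z → adj H z (f c)) fa≡fb) (f-adj b c))

-- The complement of the path 0 - 1 - 2 - 3 is the path 1 - 3 - 0 - 2.
complement-Cograph : Cograph H → Cograph (complement H)
complement-Cograph {H = H} cograph (f , f-injective , f-adj) =
  cograph (path⇒P4 H (adj-f (# 1) (# 3) λ ()) (adj-f (# 3) (# 0) λ ()) (adj-f (# 0) (# 2) λ ())
                     (adj-f (# 1) (# 0) λ ()) (adj-f (# 1) (# 2) λ ()) (adj-f (# 3) (# 2) λ ()))
  where
  adj-f : ∀ a b → a ≢ b → adj H (f a) (f b) ≡ not (p4adj a b)
  adj-f a b a≢b = begin
    adj H (f a) (f b)                     ≡⟨ not-involutive _ ⟨
    not (not (adj H (f a) (f b)))         ≡⟨ cong not (complement-adj H (a≢b ∘ f-injective)) ⟨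
    not (adj (complement H) (f a) (f b))  ≡⟨ cong not (f-adj a b) ⟩
    not (p4adj a b)                       ∎
    where open ≡-Reasoning

record Disconnection (H : Graph n) (U : Subset n) : Set where
  field
    A B         : Subset n
    A⊆U         : A ⊆ U
    B⊆U         : B ⊆ U
    covers      : x ∈ U → x ∈ A ⊎ x ∈ B
    disjoint    : x ∈ A → x ∉ B
    A-nonempty  : Nonempty A
    B-nonempty  : Nonempty B
    no-edge     : x ∈ A → y ∈ B → adj H x y ≡ false

open Disconnection

Disconnection-swap : Disconnection H U → Disconnection H U
Disconnection-swap {H = H} D = record
  { A = B D ; B = A D ; A⊆U = B⊆U D ; B⊆U = A⊆U D
  ; covers = swap ∘ covers D
  ; disjoint = λ x∈B x∈A → disjoint D x∈A x∈B
  ; A-nonempty = B-nonempty D ; B-nonempty = A-nonempty D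
  ; no-edge = λ x∈B y∈A → adj-sym H (no-edge D y∈A x∈B)
  }

Disconnection-complement² : Disconnection (complement (complement H)) U → Disconnection H U
Disconnection-complement² {H = H} D = record
  { A = A D ; B = B D ; A⊆U = A⊆U D ; B⊆U = B⊆U D ; covers = covers D ; disjoint = disjoint D
  ; A-nonempty = A-nonempty D ; B-nonempty = B-nonempty D
  ; no-edge = λ {x} {y} x∈A y∈B → trans (sym (complement-involutive H x y)) (no-edge D x∈A y∈B)
  }

isolated-disconnection : ∀ (H : Graph n) → v ∈ U → Nonempty (U - v) →
  (∀ {u} → u ∈ U - v → adj H v u ≡ false) → Disconnection H U
isolated-disconnection {v = v} {U} H v∈U U-v-nonempty v-isolated = record
  { A = ⁅ v ⁆ ; B = U - v ; A⊆U = ⁅x⁆⊆p v∈U ; B⊆U = p─q⊆p U ⁅ v ⁆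
  ; covers = covers′
  ; disjoint = λ x∈⁅v⁆ x∈U-v → x∈p-y⇒x≢y U x∈U-v (x∈⁅y⁆⇒x≡y v x∈⁅v⁆)
  ; A-nonempty = v , x∈⁅x⁆ v ; B-nonempty = U-v-nonempty
  ; no-edge = no-edge′
  }
  where
  covers′ : x ∈ U → x ∈ ⁅ v ⁆ ⊎ x ∈ U - v
  covers′ {x} x∈U with x ≟ v
  ... | yes refl = inj₁ (x∈⁅x⁆ v)
  ... | no x≢v = inj₂ (x∈p∧x≢y⇒x∈p-y x∈U x≢v)
  no-edge′ : x ∈ ⁅ v ⁆ → y ∈ U - v → adj H x y ≡ false
  no-edge′ x∈⁅v⁆ y∈U-v with refl ← x∈⁅y⁆⇒x≡y v x∈⁅v⁆ = v-isolated y∈U-v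

Disconnection-insert : (D : Disconnection H (U - v)) → v ∈ U →
  (∀ {a} → a ∈ A D → adj H v a ≡ false) → Disconnection H U
Disconnection-insert {H = H} {U} {v} D v∈U v-isolated-from-A = record
  { A = A D ; B = B D ∪ ⁅ v ⁆
  ; A⊆U = p─q⊆p U ⁅ v ⁆ ∘ A⊆U D
  ; B⊆U = [ p─q⊆p U ⁅ v ⁆ ∘ B⊆U D , ⁅x⁆⊆p v∈U ] ∘ x∈p∪q⁻ (B D) ⁅ v ⁆
  ; covers = covers′
  ; disjoint = λ x∈A →
      [ disjoint D x∈A , x∈p-y⇒x≢y U (A⊆U D x∈A) ∘ x∈⁅y⁆⇒x≡y v ] ∘ x∈p∪q⁻ (B D) ⁅ v ⁆
  ; A-nonempty = A-nonempty D ; B-nonempty = v , x∈p∪q⁺ (inj₂ (x∈⁅x⁆ v))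
  ; no-edge = λ x∈A → [ no-edge D x∈A , no-edge-v x∈A ] ∘ x∈p∪q⁻ (B D) ⁅ v ⁆
  }
  where
  covers′ : x ∈ U → x ∈ A D ⊎ x ∈ B D ∪ ⁅ v ⁆
  covers′ {x} x∈U with x ≟ v
  ... | yes refl = inj₂ (x∈p∪q⁺ (inj₂ (x∈⁅x⁆ v)))
  ... | no x≢v = map₂ (x∈p∪q⁺ ∘ inj₁) (covers D (x∈p∧x≢y⇒x∈p-y x∈U x≢v))
  no-edge-v : x ∈ A D → y ∈ ⁅ v ⁆ → adj H x y ≡ false
  no-edge-v x∈A y∈⁅v⁆ with refl ← x∈⁅y⁆⇒x≡y v y∈⁅v⁆ = adj-sym H (v-isolated-from-A x∈A)

same-side⇒P4 : ∀ (H : Graph n) (D : Disconnection H X) {m w b} → m ∈ A D → w ∈ A D → b ∈ B D →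
  adj H m w ≡ true → adj H v w ≡ true → adj H v b ≡ true → adj H v m ≡ false → HasInducedP4 H
same-side⇒P4 H D m∈A w∈A b∈B mw vw vb vm =
  path⇒P4 H mw (adj-sym H vw) vb (adj-sym H vm) (no-edge D m∈A b∈B) (no-edge D w∈A b∈B)

-- The non-neighbours of v are a union of components: an edge m – w leaving them, together with
-- a neighbour b of v on the side not containing m and w, would give an induced path m – w – v – b.
non-neighbours-closed : Cograph H → (D : Disconnection H X) → ∀ {a b m w} →
  a ∈ A D → adj H v a ≡ true → b ∈ B D → adj H v b ≡ true →
  m ∈ X → adj H v m ≡ false → w ∈ X → adj H m w ≡ true → adj H v w ≡ false
non-neighbours-closed {H = H} {v = v} cograph D {w = w} a∈A va b∈B vb m∈X vm w∈X mw
  with adj H v w in vw | covers D m∈X | covers D w∈X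
... | false | _ | _ = refl
... | true | inj₁ m∈A | inj₁ w∈A = contradiction (same-side⇒P4 H D m∈A w∈A b∈B mw vw vb vm) cograph
... | true | inj₂ m∈B | inj₂ w∈B =
  contradiction (same-side⇒P4 H (Disconnection-swap D) m∈B w∈B a∈A mw vw va vm) cograph
... | true | inj₁ m∈A | inj₂ w∈B = contradiction (no-edge D m∈A w∈B) (not-¬ mw)
... | true | inj₂ m∈B | inj₁ w∈A = contradiction (no-edge D w∈A m∈B) (not-¬ (adj-sym H mw))

non-neighbour-disconnection : Cograph H → v ∈ U → (D : Disconnection H (U - v)) → ∀ {a b m} →
  a ∈ A D → adj H v a ≡ true → b ∈ B D → adj H v b ≡ true →
  m ∈ U - v → adj H v m ≡ false → Disconnection H U
non-neighbour-disconnection {H = H} {v} {U} cograph v∈U D a∈A va b∈B vb m∈U-v vm = record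
  { A = M ; B = U ─ M
  ; A⊆U = p─q⊆p U ⁅ v ⁆ ∘ p∩q⊆p (U - v) _
  ; B⊆U = p─q⊆p U M
  ; covers = covers′
  ; disjoint = λ x∈M x∈U─M → x∈p─q⇒x∉q U M x∈U─M x∈M
  ; A-nonempty = _ , x∈p∩q⁺ (m∈U-v , x∉p⇒x∈∁p (∉nbhd⁺ H vm))
  ; B-nonempty = v , x∈p∧x∉q⇒x∈p─q v∈U (λ v∈M → x∈p-y⇒x≢y U (p∩q⊆p (U - v) _ v∈M) refl)
  ; no-edge = no-edge′
  }
  where
  M : Subset _
  M = (U - v) ∩ ∁ (nbhd H v)
  covers′ : x ∈ U → x ∈ M ⊎ x ∈ U ─ M
  covers′ {x} x∈U with x ∈? M
  ... | yes x∈M = inj₁ x∈M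
  ... | no x∉M = inj₂ (x∈p∧x∉q⇒x∈p─q x∈U x∉M)
  no-edge′ : x ∈ M → y ∈ U ─ M → adj H x y ≡ false
  no-edge′ {x} {y} x∈M y∈U─M = ¬-not λ xy → x∈p─q⇒x∉q U M y∈U─M (y∈M xy)
    where
    x∈U-v : x ∈ U - v
    x∈U-v = p∩q⊆p (U - v) _ x∈M
    vx : adj H v x ≡ false
    vx = ∉nbhd⁻ H (x∈∁p⇒x∉p (p∩q⊆q (U - v) _ x∈M))
    y∈M : adj H x y ≡ true → y ∈ M
    y∈M xy = x∈p∩q⁺ (y∈U-v , x∉p⇒x∈∁p (∉nbhd⁺ H
      (non-neighbours-closed cograph D a∈A va b∈B vb x∈U-v vx y∈U-v xy)))
      where
      y∈U-v : y ∈ U - v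
      y∈U-v = x∈p∧x≢y⇒x∈p-y (p─q⊆p U M y∈U─M) λ { refl → not-¬ (adj-sym H vx) xy }

Disconnection-extend : Cograph H → v ∈ U → Disconnection H (U - v) →
  Disconnection H U ⊎ Disconnection (complement H) U
Disconnection-extend {H = H} {v} {U} cograph v∈U D
  with constant-or-witness (adj H v) false (A D) | constant-or-witness (adj H v) false (B D)
... | inj₁ v-isolated-from-A | _ = inj₁ (Disconnection-insert D v∈U v-isolated-from-A)
... | _ | inj₁ v-isolated-from-B =
  inj₁ (Disconnection-swap (Disconnection-insert (Disconnection-swap D) v∈U v-isolated-from-B))
... | inj₂ (a , a∈A , va) | inj₂ (b , b∈B , vb) with constant-or-witness (adj H v) true (U - v)
...   | inj₁ v-universal = inj₂ (isolated-disconnection (complement H) v∈U (a , A⊆U D a∈A)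
                                   (complement-false H ∘ v-universal))
...   | inj₂ (m , m∈U-v , vm) =
  inj₁ (non-neighbour-disconnection cograph v∈U D a∈A va b∈B vb m∈U-v vm)

-- Unless x is isolated or universal in U, a neighbour z₁ and a non-neighbour z₀ of x
-- provide the two vertices needed to recurse on U - x.
cograph-disconnection : Acc ℕ._<_ ∣ U ∣ → Cograph H → x ∈ U → Nonempty (U - x) →
  Disconnection H U ⊎ Disconnection (complement H) U
cograph-disconnection {U = U} {H = H} {x} (acc smaller) cograph x∈U U-x-nonempty
  with constant-or-witness (adj H x) false (U - x) | constant-or-witness (adj H x) true (U - x)
... | inj₁ x-isolated | _ = inj₁ (isolated-disconnection H x∈U U-x-nonempty x-isolated)
... | _ | inj₁ x-universal =
  inj₂ (isolated-disconnection (complement H) x∈U U-x-nonempty (complement-false H ∘ x-universal))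
... | inj₂ (z₁ , z₁∈U-x , xz₁) | inj₂ (z₀ , z₀∈U-x , xz₀)
  with cograph-disconnection (smaller (x∈p⇒∣p-x∣<∣p∣ x∈U)) cograph z₁∈U-x
         (z₀ , x∈p∧x≢y⇒x∈p-y z₀∈U-x λ { refl → not-¬ xz₁ xz₀ })
...   | inj₁ D = Disconnection-extend cograph x∈U D
...   | inj₂ D = swap (map₂ Disconnection-complement²
                            (Disconnection-extend (complement-Cograph cograph) x∈U D))

module SparseDensePairs where

  open import Data.Nat using (_+_; _*_; _≤_; _<_; _≤?_; s≤s)
  open import Data.Nat.Properties
    using ( ≤-refl; ≤-reflexive; ≤-trans; <-≤-trans; ≤-<-trans; <⇒≤; ≰⇒>; +-suc; +-mono-≤
          ; *-comm; *-distribˡ-+; *-distribʳ-+; *-monoˡ-≤; *-monoʳ-≤; module ≤-Reasoning)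

  nonempty : ∀ (p : Subset n) → 0 < ∣ p ∣ → Nonempty p
  nonempty (inside ∷ p) _ = zero , here
  nonempty (outside ∷ p) 0<∣p∣ = Product.map suc there (nonempty p 0<∣p∣)

  two-elements : ∀ (p : Subset n) → 1 < ∣ p ∣ → ∃[ x ] x ∈ p × Nonempty (p - x)
  two-elements (inside ∷ p) (s≤s 0<∣p∣) =
    let y , y∈p = nonempty p 0<∣p∣
    in zero , here , suc y , x∈p∧x≢y⇒x∈p-y {p = inside ∷ p} {y = zero} (there y∈p) λ ()
  two-elements (outside ∷ p) 1<∣p∣ =
    let x , x∈p , y , y∈p-x = two-elements p 1<∣p∣ in suc x , there x∈p , suc y , there y∈p-x

  subset-of-size : ∀ (p : Subset n) → k ≤ ∣ p ∣ → ∃[ q ] q ⊆ p × ∣ q ∣ ≡ k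
  subset-of-size {n} {zero} p _ = ⊥ , ⊥⊆ , ∣⊥∣≡0 n
  subset-of-size {k = suc k} (inside ∷ p) (s≤s k≤∣p∣) =
    let q , q⊆p , ∣q∣≡k = subset-of-size p k≤∣p∣ in inside ∷ q , s⊆s q⊆p , cong suc ∣q∣≡k
  subset-of-size {k = suc k} (outside ∷ p) k<∣p∣ =
    let q , q⊆p , ∣q∣≡k = subset-of-size p k<∣p∣ in outside ∷ q , out⊆ q⊆p , ∣q∣≡k

  ∣p∪q∣≡∣p∣+∣q∣ : ∀ (p q : Subset n) → (∀ {x} → x ∈ p → x ∉ q) → ∣ p ∪ q ∣ ≡ ∣ p ∣ + ∣ q ∣
  ∣p∪q∣≡∣p∣+∣q∣ [] [] _ = refl
  ∣p∪q∣≡∣p∣+∣q∣ (inside ∷ p) (inside ∷ q) disjoint = contradiction here (disjoint here)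
  ∣p∪q∣≡∣p∣+∣q∣ (inside ∷ p) (outside ∷ q) disjoint =
    cong suc (∣p∪q∣≡∣p∣+∣q∣ p q λ x∈p x∈q → disjoint (there x∈p) (there x∈q))
  ∣p∪q∣≡∣p∣+∣q∣ (outside ∷ p) (inside ∷ q) disjoint =
    trans (cong suc (∣p∪q∣≡∣p∣+∣q∣ p q λ x∈p x∈q → disjoint (there x∈p) (there x∈q)))
          (sym (+-suc ∣ p ∣ ∣ q ∣))
  ∣p∪q∣≡∣p∣+∣q∣ (outside ∷ p) (outside ∷ q) disjoint =
    ∣p∪q∣≡∣p∣+∣q∣ p q λ x∈p x∈q → disjoint (there x∈p) (there x∈q)

  Disconnection-∣A∣+∣B∣ : (D : Disconnection H U) → ∣ U ∣ ≡ ∣ A D ∣ + ∣ B D ∣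
  Disconnection-∣A∣+∣B∣ {U = U} D = trans (cong ∣_∣ U≡A∪B) (∣p∪q∣≡∣p∣+∣q∣ (A D) (B D) (disjoint D))
    where
    U≡A∪B : U ≡ A D ∪ B D
    U≡A∪B = ⊆-antisym (x∈p∪q⁺ ∘ covers D) ([ A⊆U D , B⊆U D ] ∘ x∈p∪q⁻ (A D) (B D))

  Disconnection-∣A∣<∣U∣ : (D : Disconnection H U) → ∣ A D ∣ < ∣ U ∣
  Disconnection-∣A∣<∣U∣ D =
    let b , b∈B = B-nonempty D in p⊂q⇒∣p∣<∣q∣ (A⊆U D , b , B⊆U D b∈B , λ b∈A → disjoint D b∈A b∈B)

  Disconnection-∣B∣<∣U∣ : (D : Disconnection H U) → ∣ B D ∣ < ∣ U ∣
  Disconnection-∣B∣<∣U∣ D = Disconnection-∣A∣<∣U∣ (Disconnection-swap D)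

  MaxDegreeBelow : Graph n → Subset n → ℕ → Set
  MaxDegreeBelow H X k = ∀ {v} → v ∈ X → degIn H X v < k

  MaxDegreeBelow-small : ∀ (H : Graph n) → ∣ X ∣ ≤ k → MaxDegreeBelow H X k
  MaxDegreeBelow-small {X = X} H ∣X∣≤k {v} v∈X = <-≤-trans (p⊂q⇒∣p∣<∣q∣ X∩N⊂X) ∣X∣≤k
    where
    X∩N⊂X : X ∩ nbhd H v ⊂ X
    X∩N⊂X = p∩q⊆p X _ , v , v∈X , ∉nbhd⁺ H (irrefl H v) ∘ p∩q⊆q X _

  degIn-∪-≤ : ∀ (H : Graph n) P Q {v} → (∀ {x} → x ∈ Q → adj H v x ≡ false) →
    degIn H (P ∪ Q) v ≤ degIn H P v
  degIn-∪-≤ H P Q {v} v-isolated-from-Q = p⊆q⇒∣p∣≤∣q∣ λ x∈ →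
    let x∈P∪Q , x∈N = x∈p∩q⁻ (P ∪ Q) _ x∈ in x∈p∩q⁺ (in-P x∈N (x∈p∪q⁻ P Q x∈P∪Q) , x∈N)
    where
    in-P : ∀ {x} → x ∈ nbhd H v → x ∈ P ⊎ x ∈ Q → x ∈ P
    in-P _ (inj₁ x∈P) = x∈P
    in-P x∈N (inj₂ x∈Q) = contradiction (∈nbhd⁻ H x∈N) (not-¬ (v-isolated-from-Q x∈Q))

  MaxDegreeBelow-∪ : ∀ (H : Graph n) → (∀ {x y} → x ∈ P → y ∈ Q → adj H x y ≡ false) →
    MaxDegreeBelow H P k → MaxDegreeBelow H Q k → MaxDegreeBelow H (P ∪ Q) k
  MaxDegreeBelow-∪ {P = P} {Q = Q} H no-edge P-sparse Q-sparse {v} v∈P∪Q with x∈p∪q⁻ P Q v∈P∪Q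
  ... | inj₁ v∈P = ≤-<-trans (degIn-∪-≤ H P Q (no-edge v∈P)) (P-sparse v∈P)
  ... | inj₂ v∈Q = ≤-<-trans (subst (_≤ degIn H Q v) (cong (λ X → degIn H X v) (∪-comm Q P))
                                    (degIn-∪-≤ H Q P λ x∈P → adj-sym H (no-edge x∈P v∈Q)))
                             (Q-sparse v∈Q)

  MaxDegreeBelow-complement² : ∀ (H : Graph n) →
    MaxDegreeBelow (complement (complement H)) X k → MaxDegreeBelow H X k
  MaxDegreeBelow-complement² {X = X} H sparse {v} v∈X =
    subst (_< _) (cong (λ N → ∣ X ∩ N ∣) (tabulate-cong (complement-involutive H v))) (sparse v∈X)

  -- Only C ⊆ U is required, not C ⊆ P: if |P| < k, the pair (P, any k-subset of U) will do.
  record SparseDensePair (H : Graph n) (P U : Subset n) (k : ℕ) : Set where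
    field
      S C         : Subset n
      S⊆P         : S ⊆ P
      C⊆U         : C ⊆ U
      S-sparse    : MaxDegreeBelow H S k
      C-dense     : MaxDegreeBelow (complement H) C k
      k∣P∣≤∣S∣∣C∣ : k * ∣ P ∣ ≤ ∣ S ∣ * ∣ C ∣

  SparseDensePair-complement : SparseDensePair (complement H) U U k → SparseDensePair H U U k
  SparseDensePair-complement {H = H} {U} {k} pair = record
    { S = C ; C = S ; S⊆P = C⊆U ; C⊆U = S⊆P
    ; S-sparse = MaxDegreeBelow-complement² H C-dense ; C-dense = S-sparse
    ; k∣P∣≤∣S∣∣C∣ = subst (k * ∣ U ∣ ≤_) (*-comm ∣ S ∣ ∣ C ∣) k∣P∣≤∣S∣∣C∣
    }
    where open SparseDensePair pair

  SparseDensePair-widen : ∀ (H : Graph n) → P ⊆ U → k ≤ ∣ U ∣ →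
    (k ≤ ∣ P ∣ → SparseDensePair H P P k) → SparseDensePair H P U k
  SparseDensePair-widen {P = P} {U = U} {k = k} H P⊆U k≤∣U∣ pair-of-P with k ≤? ∣ P ∣
  ... | yes k≤∣P∣ = record
    { SparseDensePair (pair-of-P k≤∣P∣)
    ; C⊆U = P⊆U ∘ SparseDensePair.C⊆U (pair-of-P k≤∣P∣)
    }
  ... | no k≰∣P∣ = let K , K⊆U , ∣K∣≡k = subset-of-size U k≤∣U∣ in record
    { S = P ; C = K ; S⊆P = λ x∈P → x∈P ; C⊆U = K⊆U
    ; S-sparse = MaxDegreeBelow-small H (<⇒≤ (≰⇒> k≰∣P∣))
    ; C-dense = MaxDegreeBelow-small (complement H) (≤-reflexive ∣K∣≡k)
    ; k∣P∣≤∣S∣∣C∣ = ≤-reflexive (trans (*-comm k ∣ P ∣) (cong (∣ P ∣ *_) (sym ∣K∣≡k)))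
    }

  k*[a+b]≤[s+t]*e : ∀ k {a b} s t {c d e} → k * a ≤ s * c → k * b ≤ t * d → c ≤ e → d ≤ e →
    k * (a + b) ≤ (s + t) * e
  k*[a+b]≤[s+t]*e k {a} {b} s t {c} {d} {e} ka≤sc kb≤td c≤e d≤e = begin
    k * (a + b)    ≡⟨ *-distribˡ-+ k a b ⟩
    k * a + k * b  ≤⟨ +-mono-≤ ka≤sc kb≤td ⟩
    s * c + t * d  ≤⟨ +-mono-≤ (*-monoʳ-≤ s c≤e) (*-monoʳ-≤ t d≤e) ⟩
    s * e + t * e  ≡⟨ *-distribʳ-+ e s t ⟨
    (s + t) * e    ∎
    where open ≤-Reasoning

  module _ (H : Graph n) (D : Disconnection H U)
           (pairᴬ : SparseDensePair H (A D) U k) (pairᴮ : SparseDensePair H (B D) U k) where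
    private
      module Pᴬ = SparseDensePair pairᴬ
      module Pᴮ = SparseDensePair pairᴮ

    SparseDensePair-∪ : ∀ {C} → C ⊆ U → MaxDegreeBelow (complement H) C k →
      ∣ Pᴬ.C ∣ ≤ ∣ C ∣ → ∣ Pᴮ.C ∣ ≤ ∣ C ∣ → SparseDensePair H U U k
    SparseDensePair-∪ {C} C⊆U C-dense ∣Cᴬ∣≤∣C∣ ∣Cᴮ∣≤∣C∣ = record
      { S = Pᴬ.S ∪ Pᴮ.S ; C = C
      ; S⊆P = [ A⊆U D ∘ Pᴬ.S⊆P , B⊆U D ∘ Pᴮ.S⊆P ] ∘ x∈p∪q⁻ Pᴬ.S Pᴮ.S
      ; C⊆U = C⊆U
      ; S-sparse = MaxDegreeBelow-∪ H (λ x∈Sᴬ y∈Sᴮ → no-edge D (Pᴬ.S⊆P x∈Sᴬ) (Pᴮ.S⊆P y∈Sᴮ))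
                     Pᴬ.S-sparse Pᴮ.S-sparse
      ; C-dense = C-dense
      ; k∣P∣≤∣S∣∣C∣ = subst₂ (λ u s → k * u ≤ s * ∣ C ∣) (sym (Disconnection-∣A∣+∣B∣ D))
          (sym (∣p∪q∣≡∣p∣+∣q∣ Pᴬ.S Pᴮ.S λ x∈Sᴬ → disjoint D (Pᴬ.S⊆P x∈Sᴬ) ∘ Pᴮ.S⊆P))
          (k*[a+b]≤[s+t]*e k ∣ Pᴬ.S ∣ ∣ Pᴮ.S ∣ Pᴬ.k∣P∣≤∣S∣∣C∣ Pᴮ.k∣P∣≤∣S∣∣C∣ ∣Cᴬ∣≤∣C∣ ∣Cᴮ∣≤∣C∣)
      }

    SparseDensePair-join : SparseDensePair H U U k
    SparseDensePair-join with ∣ Pᴬ.C ∣ ≤? ∣ Pᴮ.C ∣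
    ... | yes ∣Cᴬ∣≤∣Cᴮ∣ = SparseDensePair-∪ Pᴮ.C⊆U Pᴮ.C-dense ∣Cᴬ∣≤∣Cᴮ∣ ≤-refl
    ... | no ∣Cᴬ∣≰∣Cᴮ∣ = SparseDensePair-∪ Pᴬ.C⊆U Pᴬ.C-dense ≤-refl (<⇒≤ (≰⇒> ∣Cᴬ∣≰∣Cᴮ∣))

  SparseDensePair-split : ∀ (H : Graph n) → Disconnection H U → k ≤ ∣ U ∣ →
    (∀ {P} → ∣ P ∣ < ∣ U ∣ → k ≤ ∣ P ∣ → SparseDensePair H P P k) → SparseDensePair H U U k
  SparseDensePair-split H D k≤∣U∣ pair-of-smaller = SparseDensePair-join H D
    (SparseDensePair-widen H (A⊆U D) k≤∣U∣ (pair-of-smaller (Disconnection-∣A∣<∣U∣ D)))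
    (SparseDensePair-widen H (B⊆U D) k≤∣U∣ (pair-of-smaller (Disconnection-∣B∣<∣U∣ D)))

  sparseDensePair : Acc _<_ ∣ U ∣ → Cograph H → k ≤ ∣ U ∣ → SparseDensePair H U U k
  sparseDensePair {n} {H = H} {k = zero} _ _ _ = record
    { S = ⊥ ; C = ⊥ ; S⊆P = ⊥⊆ ; C⊆U = ⊥⊆
    ; S-sparse = MaxDegreeBelow-small H (≤-reflexive (∣⊥∣≡0 n))
    ; C-dense = MaxDegreeBelow-small (complement H) (≤-reflexive (∣⊥∣≡0 n))
    ; k∣P∣≤∣S∣∣C∣ = z≤n
    }
  sparseDensePair {U = U} {H = H} {k = suc k} (acc smaller) cograph k≤∣U∣ with ∣ U ∣ ≤? suc k
  ... | yes ∣U∣≤k = record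
    { S = U ; C = U ; S⊆P = λ x∈U → x∈U ; C⊆U = λ x∈U → x∈U
    ; S-sparse = MaxDegreeBelow-small H ∣U∣≤k
    ; C-dense = MaxDegreeBelow-small (complement H) ∣U∣≤k
    ; k∣P∣≤∣S∣∣C∣ = *-monoˡ-≤ ∣ U ∣ k≤∣U∣
    }
  ... | no ∣U∣≰k with two-elements U (≤-trans (s≤s (s≤s z≤n)) (≰⇒> ∣U∣≰k))
  ...   | x , x∈U , U-x-nonempty
    with cograph-disconnection (<-wellFounded _) cograph x∈U U-x-nonempty
  ...     | inj₁ D = SparseDensePair-split H D k≤∣U∣ λ lt → sparseDensePair (smaller lt) cograph
  ...     | inj₂ D = SparseDensePair-complement (SparseDensePair-split (complement H) D k≤∣U∣
                       λ lt → sparseDensePair (smaller lt) (complement-Cograph cograph))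

  module _ (pair : SparseDensePair H P U k) where
    open SparseDensePair pair

    SparseDensePair-larger :
      ∃[ X ] k * ∣ P ∣ ≤ ∣ X ∣ * ∣ X ∣ × (MaxDegreeBelow H X k ⊎ MaxDegreeBelow (complement H) X k)
    SparseDensePair-larger with ∣ C ∣ ≤? ∣ S ∣
    ... | yes ∣C∣≤∣S∣ = S , ≤-trans k∣P∣≤∣S∣∣C∣ (*-monoʳ-≤ ∣ S ∣ ∣C∣≤∣S∣) , inj₁ S-sparse
    ... | no ∣C∣≰∣S∣ = C , ≤-trans k∣P∣≤∣S∣∣C∣ (*-monoˡ-≤ ∣ C ∣ (<⇒≤ (≰⇒> ∣C∣≰∣S∣))) , inj₂ C-dense

  large-sparse-or-dense : ∀ {G : Graph n} → Cograph G → k ≤ n →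
    ∃[ X ] k * n ≤ ∣ X ∣ * ∣ X ∣ × (MaxDegreeBelow G X k ⊎ MaxDegreeBelow (complement G) X k)
  large-sparse-or-dense {n} {k} cograph k≤n =
    Product.map₂ (λ {X} → Product.map₁ (subst (λ m → k * m ≤ ∣ X ∣ * ∣ X ∣) (∣⊤∣≡n n)))
      (SparseDensePair-larger
        (sparseDensePair {U = ⊤} (<-wellFounded _) cograph (subst (k ≤_) (sym (∣⊤∣≡n n)) k≤n)))

open SparseDensePairs using (MaxDegreeBelow; large-sparse-or-dense)

open import Data.Rational using (ℚ; mkℚ; 0ℚ; 1ℚ; _≤_; _<_; _*_; *≤*; _≤?_; nonNegative; positive)
open import Data.Rational.Properties
  using ( ↥p/↧p≡p; ≤-trans; <-≤-trans; ≤-<-trans; <⇒≤; ≰⇒>; ≮⇒≥; <-irrefl; *-identityˡ; *-identityʳ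
        ; *-monoˡ-≤-nonNeg; *-monoʳ-≤-nonNeg; *-monoˡ-<-pos; module ≤-Reasoning)
open import Data.Rational.Solver using (module +-*-Solver)

-- toℚ m = + m / 1 normalises through gcd m 1, which does not reduce for a variable m.
toℚ≡mkℚ : ∀ m → toℚ m ≡ mkℚ (+ m) 0 (Coprimality.sym (1-coprimeTo m))
toℚ≡mkℚ m = ↥p/↧p≡p _

toℚ-mono-≤ : ∀ {m n} → m ℕ.≤ n → toℚ m ≤ toℚ n
toℚ-mono-≤ {m} {n} m≤n rewrite toℚ≡mkℚ m | toℚ≡mkℚ n =
  *≤* (subst₂ ℤ._≤_ (sym (ℤ.*-identityʳ (+ m))) (sym (ℤ.*-identityʳ (+ n))) (+≤+ m≤n))

0≤toℚ : ∀ n → 0ℚ ≤ toℚ n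
0≤toℚ n = toℚ-mono-≤ (z≤n {n})

toℚ-* : ∀ m n → toℚ (m ℕ.* n) ≡ toℚ m * toℚ n
toℚ-* m n rewrite toℚ≡mkℚ m | toℚ≡mkℚ n = cong (Data.Rational._/ 1) (ℤ.pos-* m n)

ℕ-ceiling : ∀ (t : ℚ) n → t ≤ toℚ n →
  ∃[ k ] k ℕ.≤ n × t ≤ toℚ k × (∀ {d} → d ℕ.< k → toℚ d ≤ t)
ℕ-ceiling t zero t≤0 = zero , z≤n , t≤0 , λ ()
ℕ-ceiling t (suc n) t≤1+n with t ≤? toℚ n
... | yes t≤n =
  let k , k≤n , t≤k , below-k = ℕ-ceiling t n t≤n in k , ℕ.m≤n⇒m≤1+n k≤n , t≤k , below-k
... | no t≰n =
  suc n , ℕ.≤-refl , t≤1+n , λ d<1+n → ≤-trans (toℚ-mono-≤ (ℕ.≤-pred d<1+n)) (<⇒≤ (≰⇒> t≰n))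

p*p≤q*q⇒p≤q : ∀ {p q} → 0ℚ ≤ q → p * p ≤ q * q → p ≤ q
p*p≤q*q⇒p≤q {p} {q} 0≤q p*p≤q*q = ≮⇒≥ λ q<p → <-irrefl refl (<-≤-trans (q*q<p*p q<p) p*p≤q*q)
  where
  q*q<p*p : q < p → q * q < p * p
  q*q<p*p q<p = begin-strict
    q * q  ≤⟨ *-monoˡ-≤-nonNeg q {{nonNegative 0≤q}} (<⇒≤ q<p) ⟩
    q * p  <⟨ *-monoˡ-<-pos p {{positive (≤-<-trans 0≤q q<p)}} q<p ⟩
    p * p  ∎
    where open ≤-Reasoning

ε*ε*n≤n : ∀ {ε} n → 0ℚ ≤ ε → ε ≤ 1ℚ → ε * ε * toℚ n ≤ toℚ n
ε*ε*n≤n {ε} n 0≤ε ε≤1 = begin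
  ε * ε * toℚ n  ≤⟨ *-monoʳ-≤-nonNeg (toℚ n) {{nonNegative (0≤toℚ n)}} ε*ε≤1 ⟩
  1ℚ * toℚ n     ≡⟨ *-identityˡ (toℚ n) ⟩
  toℚ n          ∎
  where
  open ≤-Reasoning
  ε*ε≤1 : ε * ε ≤ 1ℚ
  ε*ε≤1 = begin
    ε * ε   ≤⟨ *-monoˡ-≤-nonNeg ε {{nonNegative 0≤ε}} ε≤1 ⟩
    ε * 1ℚ  ≡⟨ *-identityʳ ε ⟩
    ε       ≤⟨ ε≤1 ⟩
    1ℚ      ∎

ε*n≤m : ∀ ε n k m → ε * ε * toℚ n ≤ toℚ k → k ℕ.* n ℕ.≤ m ℕ.* m → ε * toℚ n ≤ toℚ m
ε*n≤m ε n k m ε*ε*n≤k k*n≤m*m = p*p≤q*q⇒p≤q (0≤toℚ m) (begin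
  (ε * toℚ n) * (ε * toℚ n)  ≡⟨ solve 2 (λ e x → (e :* x) :* (e :* x) := e :* e :* x :* x)
                                       refl ε (toℚ n) ⟩
  ε * ε * toℚ n * toℚ n      ≤⟨ *-monoʳ-≤-nonNeg (toℚ n) {{nonNegative (0≤toℚ n)}} ε*ε*n≤k ⟩
  toℚ k * toℚ n              ≡⟨ toℚ-* k n ⟨
  toℚ (k ℕ.* n)              ≤⟨ toℚ-mono-≤ k*n≤m*m ⟩
  toℚ (m ℕ.* m)              ≡⟨ toℚ-* m m ⟩
  toℚ m * toℚ m              ∎)
  where
  open ≤-Reasoning
  open +-*-Solver

MaxDegreeBelow⇒MaxDegreeAtMost : ∀ (H : Graph n) {t} → (∀ {d} → d ℕ.< k → toℚ d ≤ t) →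
  MaxDegreeBelow H X k → MaxDegreeAtMost H X t
MaxDegreeBelow⇒MaxDegreeAtMost H below-k sparse _ v∈X = below-k (sparse v∈X)

mainTheorem1 : (ε : ℚ) → 0ℚ ≤ ε → ε ≤ 1ℚ →
    (n : ℕ) (G : Graph n) → Cograph G →
    Σ (Subset n) λ X →
      (ε * toℚ n ≤ toℚ ∣ X ∣) ×
      (MaxDegreeAtMost G X (ε * ε * toℚ n) ⊎ MaxDegreeAtMost (complement G) X (ε * ε * toℚ n))
mainTheorem1 ε 0≤ε ε≤1 n G cograph =
  let k , k≤n , ε*ε*n≤k , below-k = ℕ-ceiling (ε * ε * toℚ n) n (ε*ε*n≤n n 0≤ε ε≤1)
      X , k*n≤∣X∣*∣X∣ , X-sparse-or-dense = large-sparse-or-dense cograph k≤n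
  in X , ε*n≤m ε n k ∣ X ∣ ε*ε*n≤k k*n≤∣X∣*∣X∣ ,
     Sum.map (MaxDegreeBelow⇒MaxDegreeAtMost G below-k)
             (MaxDegreeBelow⇒MaxDegreeAtMost (complement G) below-k) X-sparse-or-dense
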